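{- FIFO is an $O(m)$-approximation for F-WGP: there is an absolute constant $c>0$ such that for every instance with $m$ packets, the maximum flow time $\max_j F_j$ of the FIFO schedule is at most $c\cdot m$ times the optimal maximum flow time over all feasible schedules.
   Context: The Wireless Gathering Problem (WGP). An instance consists of a finite connected undirected graph $G=(V,E)$, a sink node $s\in V$, a positive integer $d_I$ (interference radius), and a set of packets $J=\{1,\dots,m\}$; each packet $j$ has an origin $o_j\in V$ and a release date $r_j\in\mathbb{Z}_{\ge 0}$. Time is divided into rounds $0,1,2,\dots$. In a round, if $u,v$ are adjacent, $u$ may send a packet it currently holds to $v$; this is a call $(u,v)$. Let $d(u,v)$ be the shortest-path distance in $G$. Two calls $(u,v)$ and $(u',v')$ in the same round interfere if $d(u',v)\le d_I$ or $d(u,v')\le d_I$; otherwise they are compatible. A feasible schedule specifies, for each round, a set of pairwise compatible calls, each moving one packet, such that every packet exists in a unique copy, packet $j$ is not sent before round $r_j$, and every packet eventually reaches $s$. If $x_j^t$ is the node holding $j$ at time $t$ (a packet sent in round $t$ is at its new node at time $t+1$), the completion time is $C_j=\min\{t: x_j^t=s\}$ and the flow time is $F_j=C_j-r_j$. F-WGP is the problem of finding a feasible schedule minimizing $\max_j F_j$. Priority Greedy: each packet is given a unique priority; in every round, the available packets (released and not yet at $s$) are considered in order of decreasing priority, and each is sent from its current node to a neighbor one step closer to $s$, provided this call causes no interference with the calls already chosen in this round for higher-priority packets. FIFO is the Priority Greedy algorithm in which packets with earlier release dates have higher priority (ties broken arbitrarily). -}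

module Defs where

open import Data.Nat using (ℕ; zero; suc; _+_; _*_; _∸_; _≤_; _<_)
open import Data.Fin using (Fin)
open import Data.Maybe using (Maybe; just; nothing; maybe)
open import Data.Product using (Σ; ∃; ∃-syntax; _×_; _,_)
open import Data.Sum using (_⊎_)
open import Relation.Nullary using (¬_)
open import Relation.Binary.PropositionalEquality using (_≡_; _≢_)

data Walk {n : ℕ} (E : Fin n → Fin n → Set) : ℕ → Fin n → Fin n → Set where
  here : ∀ {u} → Walk E zero u u
  step : ∀ {k u w v} → E u w → Walk E k w v → Walk E (suc k) u v

record Instance : Set₁ where
  field
    n         : ℕ
    E         : Fin n → Fin n → Set
    E-sym     : ∀ {u v} → E u v → E v u
    E-irrefl  : ∀ {u} → ¬ E u u
    connected : ∀ u v → ∃[ k ] Walk E k u v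
    s         : Fin n
    dI        : ℕ
    dI-pos    : 1 ≤ dI
    m         : ℕ
    origin    : Fin m → Fin n
    release   : Fin m → ℕ

module WGP (I : Instance) where
  open Instance I

  IsDist : Fin n → Fin n → ℕ → Set
  IsDist u v k = Walk E k u v × (∀ k' → Walk E k' u v → k ≤ k')

  DistLe : Fin n → Fin n → ℕ → Set
  DistLe u v r = ∃[ k ] (k ≤ r × Walk E k u v)

  Compatible : Fin n → Fin n → Fin n → Fin n → Set
  Compatible u v u' v' = ¬ DistLe u' v dI × ¬ DistLe u v' dI

  Closer : Fin n → Fin n → Set
  Closer u v = E u v × ∃[ k ] (IsDist v s k × IsDist u s (suc k))

  -- A schedule: in round t, packet j is either sent to node v (just v) or not sent.
  -- The sender is the node currently holding j.
  Schedule : Set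
  Schedule = ℕ → Fin m → Maybe (Fin n)

  pos : Schedule → Fin m → ℕ → Fin n
  pos S j zero    = origin j
  pos S j (suc t) = maybe (λ v → v) (pos S j t) (S t j)

  record Feasible (S : Schedule) : Set where
    field
      calls-ok   : ∀ t j v → S t j ≡ just v → release j ≤ t × E (pos S j t) v
      compatible : ∀ t i j v v' → i ≢ j → S t i ≡ just v → S t j ≡ just v' →
                   Compatible (pos S i t) v (pos S j t) v'
      delivered  : ∀ j → ∃[ t ] pos S j t ≡ s

  FlowTime : Schedule → Fin m → ℕ → Set
  FlowTime S j F =
    ∃[ C ] (release j ≤ C × pos S j C ≡ s ×
            (∀ t → release j ≤ t → t < C → pos S j t ≢ s) ×
            F ≡ C ∸ release j)

  Available : Schedule → Fin m → ℕ → Set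
  Available S j t = release j ≤ t × pos S j t ≢ s

  -- S is a run of Priority Greedy with priorities prio (larger = higher priority).
  PriorityGreedyRun : (Fin m → ℕ) → Schedule → Set
  PriorityGreedyRun prio S = ∀ t j →
    (¬ Available S j t → S t j ≡ nothing) ×
    (Available S j t →
      ∃[ v ] (Closer (pos S j t) v ×
        ((S t j ≡ just v ×
            (∀ i v' → prio j < prio i → S t i ≡ just v' →
               Compatible (pos S j t) v (pos S i t) v'))
         ⊎
         (S t j ≡ nothing ×
            ∃[ i ] ∃[ v' ] (prio j < prio i × S t i ≡ just v' ×
               ¬ Compatible (pos S j t) v (pos S i t) v')))))

  FIFOPriority : (Fin m → ℕ) → Set
  FIFOPriority prio = ∀ i j → release i < release j → prio j < prio i

-- Let S be any feasible schedule whose flow times are all at most B.  The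
-- trajectory of packet i in S is a walk from its origin to the sink of length at
-- most F_i ≤ B, so d(o_i, s) ≤ B.  In a Priority Greedy run every call moves a
-- packet one step closer to the sink, hence packet i is sent at most d(o_i, s)
-- times in total, and the potential
--     Φ(t) = number of calls made before round t
-- never exceeds m·B.  On the other hand, in every round in which some packet is
-- available the greedy rule makes at least one call (the packet itself is sent,
-- or it is blocked by a higher-priority call), so Φ strictly increases.  Hence a
-- packet released at r_j reaches the sink by round r_j + m·B, i.e. F_j ≤ m·B.
module Submission where

open import Defs
open import Algebra.Properties.Monoid.Sum using (sum)
open import Data.Nat using (ℕ; zero; suc; _*_; _≤_; _<_; _+_; _∸_; z≤n; s≤s; _≤?_)
open import Data.Nat.Properties
open import Data.Fin using (Fin) renaming (zero to fzero; suc to fsuc)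
open import Data.Fin.Properties using () renaming (_≟_ to _≟ᶠ_)
open import Data.Maybe using (Maybe; just; nothing)
open import Data.Maybe.Properties using (just-injective)
open import Data.Product using (Σ; ∃; ∃-syntax; _×_; _,_; proj₁; proj₂)
open import Data.Sum using (_⊎_; inj₁; inj₂)
open import Data.Empty using (⊥-elim)
open import Relation.Nullary using (¬_; yes; no; Dec)
open import Relation.Binary.PropositionalEquality
  using (_≡_; refl; sym; trans; subst; module ≡-Reasoning)
open import Function.Definitions using (Injective)

Σᶠ : ∀ {k} → (Fin k → ℕ) → ℕ
Σᶠ = sum +-0-monoid

first-from : (P : ℕ → Set) → (∀ t → Dec (P t)) → ∀ r x → P (r + x) →
             ∃[ C ] (r ≤ C × C ≤ r + x × P C × (∀ t → r ≤ t → t < C → ¬ P t))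
first-from P P? r zero p =
  r , ≤-refl , m≤m+n r 0 , subst P (+-identityʳ r) p ,
  λ t r≤t t<r → ⊥-elim (<⇒≱ t<r r≤t)
first-from P P? r (suc x) p with P? r
... | yes pr = r , ≤-refl , m≤m+n r (suc x) , pr , λ t r≤t t<r → ⊥-elim (<⇒≱ t<r r≤t)
... | no ¬pr with first-from P P? (suc r) x (subst P (+-suc r x) p)
...   | C , r<C , C≤ , pC , before =
  C , <⇒≤ r<C , subst (C ≤_) (sym (+-suc r x)) C≤ , pC , earlier
  where
  earlier : ∀ t → r ≤ t → t < C → ¬ P t
  earlier t r≤t t<C with m≤n⇒m<n∨m≡n r≤t
  ... | inj₁ r<t  = before t r<t t<C
  ... | inj₂ refl = ¬pr

Σᶠ-mono : ∀ {k} (f g : Fin k → ℕ) → (∀ i → f i ≤ g i) → Σᶠ f ≤ Σᶠ g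
Σᶠ-mono {zero}  f g f≤g = z≤n
Σᶠ-mono {suc k} f g f≤g = +-mono-≤ (f≤g fzero) (Σᶠ-mono _ _ (λ i → f≤g (fsuc i)))

Σᶠ-strict : ∀ {k} (f g : Fin k → ℕ) → (∀ i → f i ≤ g i) →
            (i₀ : Fin k) → f i₀ < g i₀ → Σᶠ f < Σᶠ g
Σᶠ-strict {suc k} f g f≤g fzero     f<g =
  +-mono-<-≤ f<g (Σᶠ-mono _ _ (λ i → f≤g (fsuc i)))
Σᶠ-strict {suc k} f g f≤g (fsuc i₀) f<g =
  +-mono-≤-< (f≤g fzero) (Σᶠ-strict _ _ (λ i → f≤g (fsuc i)) i₀ f<g)

Σᶠ-bounded : ∀ {k} B (f : Fin k → ℕ) → (∀ i → f i ≤ B) → Σᶠ f ≤ k * B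
Σᶠ-bounded {zero}  B f f≤B = z≤n
Σᶠ-bounded {suc k} B f f≤B = +-mono-≤ (f≤B fzero) (Σᶠ-bounded B _ (λ i → f≤B (fsuc i)))

snoc : ∀ {n} {E : Fin n → Fin n → Set} {k u w v} →
       Walk E k u w → E w v → Walk E (suc k) u v
snoc here         e = step e here
snoc (step e′ ws) e = step e′ (snoc ws e)

module Gathering (I : Instance) where
  open Instance I
  open WGP I

  dist-unique : ∀ {u v a b} → IsDist u v a → IsDist u v b → a ≡ b
  dist-unique (wa , a-min) (wb , b-min) = ≤-antisym (a-min _ wb) (b-min _ wa)

  flow-within : ∀ S j x → pos S j (release j + x) ≡ s →
                ∃[ F ] (FlowTime S j F × F ≤ x)
  flow-within S j x at-sink
    with first-from (λ t → pos S j t ≡ s) (λ t → pos S j t ≟ᶠ s) (release j) x at-sink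
  ... | C , r≤C , C≤r+x , pC , before =
    C ∸ release j , (C , r≤C , pC , before , refl) ,
    subst (C ∸ release j ≤_) (m+n∸m≡n (release j) x) (∸-monoˡ-≤ (release j) C≤r+x)

  module Feasibility (S : Schedule) (feasible : Feasible S) where
    open Feasible feasible

    at-origin : ∀ j t → t ≤ release j → pos S j t ≡ origin j
    at-origin j zero    _ = refl
    at-origin j (suc t) t<r with S t j in sent
    ... | nothing = at-origin j t (≤-trans (n≤1+n t) t<r)
    ... | just v  = ⊥-elim (<⇒≱ t<r (proj₁ (calls-ok t j v sent)))

    trajectory : ∀ j a x → ∃[ k ] (k ≤ x × Walk E k (pos S j a) (pos S j (a + x)))
    trajectory j a zero rewrite +-identityʳ a = 0 , z≤n , here
    trajectory j a (suc x) rewrite +-suc a x with trajectory j a x | S (a + x) j in sent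
    ... | k , k≤x , w | nothing = k , ≤-trans k≤x (n≤1+n x) , w
    ... | k , k≤x , w | just v  = suc k , s≤s k≤x , snoc w (proj₂ (calls-ok (a + x) j v sent))

    arrives : ∀ j → ∃[ x ] pos S j (release j + x) ≡ s
    arrives j with delivered j
    ... | t , at-sink with release j ≤? t
    ...   | yes r≤t = t ∸ release j , subst (λ z → pos S j z ≡ s) (sym (m+[n∸m]≡n r≤t)) at-sink
    ...   | no  r≰t = 0 , (begin
      pos S j (release j + 0) ≡⟨ at-origin j (release j + 0) (≤-reflexive (+-identityʳ _)) ⟩
      origin j                ≡⟨ sym (at-origin j t (<⇒≤ (≰⇒> r≰t))) ⟩
      pos S j t               ≡⟨ at-sink ⟩
      s                       ∎)
      where open ≡-Reasoning

    origin-within-flow : ∀ j F → FlowTime S j F → ∃[ L ] (L ≤ F × Walk E L (origin j) s)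
    origin-within-flow j _ (C , r≤C , at-sink , _ , refl)
      with trajectory j (release j) (C ∸ release j)
    ... | L , L≤F , w rewrite m+[n∸m]≡n r≤C | at-origin j (release j) ≤-refl | at-sink =
      L , L≤F , w

    origin-within : (B : ℕ) → (∀ j F → FlowTime S j F → F ≤ B) →
                    ∀ j → ∃[ L ] (L ≤ B × Walk E L (origin j) s)
    origin-within B bounded j with arrives j
    ... | x , at-sink with flow-within S j x at-sink
    ...   | F , flow , _ with origin-within-flow j F flow
    ...     | L , L≤F , w = L , ≤-trans L≤F (bounded j F flow) , w

  module Greedy (prio : Fin m → ℕ) (SF : Schedule) (run : PriorityGreedyRun prio SF) where

    available? : ∀ j t → Dec (Available SF j t)
    available? j t with release j ≤? t | pos SF j t ≟ᶠ s
    ... | yes r≤t | yes at-sink = no (λ av → proj₂ av at-sink)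
    ... | yes r≤t | no  away    = yes (r≤t , away)
    ... | no  r≰t | _           = no (λ av → r≰t (proj₁ av))

    calls-closer : ∀ t i v → SF t i ≡ just v → Closer (pos SF i t) v
    calls-closer t i v call with available? i t
    ... | no idle with trans (sym (proj₁ (run t i) idle)) call
    ...   | ()
    calls-closer t i v call | yes av with proj₂ (run t i) av
    ... | v′ , closer , inj₁ (sent , _) =
      subst (Closer (pos SF i t)) (just-injective (trans (sym sent) call)) closer
    ... | v′ , closer , inj₂ (held , _) with trans (sym held) call
    ...   | ()

    some-call : ∀ j t → Available SF j t → ∃[ i ] ∃[ v ] SF t i ≡ just v
    some-call j t av with proj₂ (run t j) av
    ... | v , _ , inj₁ (sent , _)                  = j , v , sent
    ... | v , _ , inj₂ (_ , i , v′ , _ , sent , _) = i , v′ , sent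

    call-count : Maybe (Fin n) → ℕ
    call-count nothing  = 0
    call-count (just _) = 1

    hops : Fin m → ℕ → ℕ
    hops i zero    = 0
    hops i (suc t) = hops i t + call-count (SF t i)

    module _ (i : Fin m) {L : ℕ} (path : Walk E L (origin i) s) where

      hops+dist≤ : ∀ t D → IsDist (pos SF i t) s D → hops i t + D ≤ L
      hops+dist≤ zero    D (_ , D-min) = D-min L path
      hops+dist≤ (suc t) D d with SF t i in call
      ... | nothing rewrite +-identityʳ (hops i t) = hops+dist≤ t D d
      ... | just v with calls-closer t i v call
      ...   | _ , k , dv , du rewrite dist-unique d dv | +-assoc (hops i t) 1 k =
        hops+dist≤ t (suc k) du

      hops≤ : ∀ t → hops i t ≤ L
      hops≤ zero = z≤n
      hops≤ (suc t) with SF t i in call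
      ... | nothing rewrite +-identityʳ (hops i t) = hops≤ t
      ... | just v with calls-closer t i v call
      ...   | _ , k , _ , du =
        ≤-trans (+-monoʳ-≤ (hops i t) (s≤s z≤n)) (hops+dist≤ t (suc k) du)

    Φ : ℕ → ℕ
    Φ t = Σᶠ (λ i → hops i t)

    Φ-increases : ∀ t i v → SF t i ≡ just v → Φ t < Φ (suc t)
    Φ-increases t i v call =
      Σᶠ-strict _ _ (λ i′ → m≤m+n (hops i′ t) _) i
        (subst (λ c → hops i t < hops i t + call-count c) (sym call)
               (m<m+n (hops i t) (s≤s z≤n)))

    delivered-or-Φ≥ : ∀ j x → (∃[ y ] (y < x × pos SF j (release j + y) ≡ s))
                             ⊎ (x ≤ Φ (release j + x))
    delivered-or-Φ≥ j zero = inj₂ z≤n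
    delivered-or-Φ≥ j (suc x) with delivered-or-Φ≥ j x
    ... | inj₁ (y , y<x , at-sink) = inj₁ (y , ≤-trans y<x (n≤1+n x) , at-sink)
    ... | inj₂ x≤Φ with pos SF j (release j + x) ≟ᶠ s
    ...   | yes at-sink = inj₁ (x , ≤-refl , at-sink)
    ...   | no away with some-call j (release j + x) (m≤m+n _ _ , away)
    ...     | i , v , call rewrite +-suc (release j) x =
      inj₂ (≤-trans (s≤s x≤Φ) (Φ-increases _ i v call))

    Φ≤ : (S : Schedule) → Feasible S → (B : ℕ) → (∀ j F → FlowTime S j F → F ≤ B) →
         ∀ t → Φ t ≤ m * B
    Φ≤ S feasible B bounded t = Σᶠ-bounded B _ hops≤B
      where
      hops≤B : ∀ i → hops i t ≤ B
      hops≤B i with Feasibility.origin-within S feasible B bounded i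
      ... | L , L≤B , path = ≤-trans (hops≤ i path t) L≤B

    greedy-flow≤ : (S : Schedule) → Feasible S →
                   (B : ℕ) → (∀ j F → FlowTime S j F → F ≤ B) →
                   ∀ j → ∃[ F ] (FlowTime SF j F × F ≤ m * B)
    greedy-flow≤ S feasible B bounded j with delivered-or-Φ≥ j (suc (m * B))
    ... | inj₁ (y , y≤mB , at-sink) with flow-within SF j y at-sink
    ...   | F , flow , F≤y = F , flow , ≤-trans F≤y (≤-pred y≤mB)
    greedy-flow≤ S feasible B bounded j | inj₂ mB<Φ =
      ⊥-elim (<⇒≱ mB<Φ (Φ≤ S feasible B bounded (release j + suc (m * B))))

theorem4p8 : Σ ℕ λ c → 1 ≤ c ×
    ((I : Instance) → (prio : Fin (Instance.m I) → ℕ) → Injective _≡_ _≡_ prio →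
    WGP.FIFOPriority I prio →
    (SF : WGP.Schedule I) → WGP.PriorityGreedyRun I prio SF →
    (S : WGP.Schedule I) → WGP.Feasible I S →
    (B : ℕ) → (∀ j F → WGP.FlowTime I S j F → F ≤ B) →
    ∀ j → ∃[ F ] (WGP.FlowTime I SF j F × F ≤ c * Instance.m I * B))
theorem4p8 = 1 , ≤-refl ,
  λ I prio _ _ SF run S feasible B bounded j →
    let F , flow , F≤mB = Gathering.Greedy.greedy-flow≤ I prio SF run S feasible B bounded j
    in  F , flow , subst (λ k → F ≤ k * B) (sym (*-identityˡ (Instance.m I))) F≤mB
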